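{- Let $G$ be a finite simple graph and $f_1, f_2 : G \to \mathbb{R}$ optimal (excellent) discrete Morse functions. For $q=0,1$ let $A_q^{f_1,f_2}(G)$ be the number of strongly connected pairs $(\tilde\sigma_1,\tilde\sigma_2)$ of $q$-dimensional simplices with $\tilde\sigma_1$ critical for $f_1$ and $\tilde\sigma_2$ critical for $f_2$, and let $\beta_q(G)$ be the $q$-th Betti number. Then (1) $A_0^{f_1,f_2}(G) = \beta_0(G)$; (2) $A_1^{f_1,f_2}(G) \ge \beta_1(G)$.
   Context: A simple graph is regarded as a 1-dimensional simplicial complex; $v \prec e$ means $v$ is an endpoint of $e$. A discrete Morse function on $G$ is $f: G \to \mathbb{R}$ on vertices and edges such that each vertex $v$ has at most one incident edge $e$ with $f(e) \le f(v)$, and each edge $e$ has at most one endpoint $v$ with $f(e) \le f(v)$. A simplex is critical if no such edge (for a vertex) or endpoint (for an edge) exists; $f$ is excellent if critical values are distinct. $f$ is optimal if for each $n$ the number of $n$-dimensional critical simplices equals the $n$-th Betti number. The gradient vector field $V$ of $f$ is the set of pairs $(v,e)$ with $v \prec e$ and $f(v)\ge f(e)$. A $V$-path from a vertex $v_0$ to a vertex $v_{r+1}$ is a sequence $v_0, e_0, v_1, \ldots, e_r, v_{r+1}$ with $(v_i, e_i) \in V$, $v_{i+1} \prec e_i$, $v_{i+1} \ne v_i$; a $V$-path from an edge $e_0$ to an edge $e_r$ is a sequence $e_0, v_1, e_1, \ldots, v_r, e_r$ with $v_i \prec e_{i-1}$, $(v_i,e_i) \in V$, and consecutive vertices distinct;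 a single simplex is a trivial path. Let $V_1,V_2$ be the gradient vector fields of $f_1,f_2$. For $f_1$-critical vertex $v_1$ and $f_2$-critical vertex $v_2$: $v_1$ is connected to $v_2$ if there is a $V_2$-path from $v_1$ to $v_2$, and $v_2$ is connected to $v_1$ if there is a $V_1$-path from $v_2$ to $v_1$. For $f_1$-critical edge $e_1$ and $f_2$-critical edge $e_2$: $e_1$ is connected to $e_2$ if there is a $V_1$-path from $e_1$ to $e_2$, and $e_2$ is connected to $e_1$ if there is a $V_2$-path from $e_2$ to $e_1$. Two such simplices are strongly connected if each is connected to the other (a simplex critical for both functions is strongly connected to itself via the trivial path).
   Formalization: The discrete Morse functions f₁, f₂ take values in the rationals instead of the reals. -}

module Defs where

open import Data.Nat using (ℕ; _+_; _∸_)
open import Data.Fin using (Fin; toℕ)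
open import Data.Rational using (ℚ; _≤_)
open import Data.Product using (Σ; _×_; _,_)
open import Data.Sum using (_⊎_)
open import Data.List using (List; length)
open import Data.List.Membership.Propositional using (_∈_)
open import Data.List.Relation.Unary.Unique.Propositional using (Unique)
open import Function.Bundles using (_⇔_)
open import Relation.Nullary using (¬_)
open import Relation.Binary.PropositionalEquality using (_≡_; _≢_)

HasCount : (A : Set) → (A → Set) → ℕ → Set
HasCount A P k =
  Σ (List A) λ xs → Unique xs × (∀ x → (x ∈ xs) ⇔ P x) × length xs ≡ k

record Graph (n m : ℕ) : Set where
  field
    src tgt : Fin m → Fin n
    loopless : ∀ e → src e ≢ tgt e
    simple : ∀ e e' →
      ((src e ≡ src e' × tgt e ≡ tgt e') ⊎ (src e ≡ tgt e' × tgt e ≡ src e'))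
      → e ≡ e'

module _ {n m : ℕ} (G : Graph n m) where
  open Graph G

  _≺_ : Fin n → Fin m → Set
  v ≺ e = (v ≡ src e) ⊎ (v ≡ tgt e)

  data Reach : Fin n → Fin n → Set where
    here : ∀ v → Reach v v
    there : ∀ v e w u → v ≺ e → w ≺ e → Reach w u → Reach v u

  ComponentRep : Fin n → Set
  ComponentRep v = ∀ u → Reach v u → toℕ v Data.Nat.≤ toℕ u

  IsBetti0 : ℕ → Set
  IsBetti0 k = HasCount (Fin n) ComponentRep k

  -- β₁(G) = |E| - |V| + β₀ (cycle rank of the graph)
  betti1 : ℕ → ℕ
  betti1 b0 = (m + b0) ∸ n

  record Morse : Set where
    field
      fv : Fin n → ℚ
      fe : Fin m → ℚ
      vertexCond : ∀ v e e' → v ≺ e → v ≺ e' →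
        fe e ≤ fv v → fe e' ≤ fv v → e ≡ e'
      -- the two endpoints of an edge are distinct, so "at most one
      -- endpoint v with f(e) ≤ f(v)" says: not both endpoints.
      edgeCond : ∀ e → ¬ (fe e ≤ fv (src e) × fe e ≤ fv (tgt e))

  module _ (f : Morse) where
    open Morse f

    CritV : Fin n → Set
    CritV v = ∀ e → v ≺ e → ¬ (fe e ≤ fv v)

    CritE : Fin m → Set
    CritE e = ∀ v → v ≺ e → ¬ (fe e ≤ fv v)

    Simplex : Set
    Simplex = Fin n ⊎ Fin m

    val : Simplex → ℚ
    val (Data.Sum.inj₁ v) = fv v
    val (Data.Sum.inj₂ e) = fe e

    Crit : Simplex → Set
    Crit (Data.Sum.inj₁ v) = CritV v
    Crit (Data.Sum.inj₂ e) = CritE e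

    Excellent : Set
    Excellent = ∀ σ τ → Crit σ → Crit τ → val σ ≡ val τ → σ ≡ τ

    Optimal : (b0 : ℕ) → Set
    Optimal b0 = HasCount (Fin n) CritV b0 × HasCount (Fin m) CritE (betti1 b0)

    InV : Fin n → Fin m → Set
    InV v e = v ≺ e × fe e ≤ fv v

    data VPathV : Fin n → Fin n → Set where
      stop : ∀ v → VPathV v v
      step : ∀ v e w u → InV v e → w ≺ e → w ≢ v → VPathV w u → VPathV v u

    -- tail of a V-path between edges: current vertex v paired with e
    data EPathTail : Fin n → Fin m → Fin m → Set where
      done : ∀ v e → EPathTail v e e
      next : ∀ v e w e₂ e' → w ≺ e → w ≢ v → InV w e₂ →
             EPathTail w e₂ e' → EPathTail v e e'

    VPathE : Fin m → Fin m → Set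
    VPathE e₀ e' = (e₀ ≡ e') ⊎
      Σ (Fin n) λ v₁ → Σ (Fin m) λ e₁ → v₁ ≺ e₀ × InV v₁ e₁ × EPathTail v₁ e₁ e'

  SCVertexPair : Morse → Morse → Fin n × Fin n → Set
  SCVertexPair f₁ f₂ (v₁ , v₂) =
    CritV f₁ v₁ × CritV f₂ v₂ × VPathV f₂ v₁ v₂ × VPathV f₁ v₂ v₁

  SCEdgePair : Morse → Morse → Fin m × Fin m → Set
  SCEdgePair f₁ f₂ (e₁ , e₂) =
    CritE f₁ e₁ × CritE f₂ e₂ × VPathE f₁ e₁ e₂ × VPathE f₂ e₂ e₁

{-# OPTIONS --safe #-}
-- Following the gradient of a discrete Morse function from a vertex strictly decreases the
-- value and ends at a unique critical vertex, its sink. If f₁ is optimal, the sinks of the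
-- β₀ component representatives are distinct f₁-critical vertices, hence all of them, so
-- every component contains exactly one f₁-critical vertex and f₁'s sink is constant on
-- components. Then v₁ ↦ (v₁ , f₂-sink of v₁) is a bijection from the f₁-critical vertices
-- onto the strongly connected vertex pairs.
--
-- For an f₁-critical edge e₁ that is f₂-paired, let U be the set of vertices whose f₂-flow
-- runs through e₁. The f₂-paired endpoint of e₁ lies in U and the other one does not, yet
-- both flow under f₁ to the same sink, so one of the two f₁-flows crosses the boundary of U
-- along an f₁-paired edge e₂. Edges other than e₁ that are f₂-paired do not separate U, so
-- e₂ is f₂-critical, and the two flows provide the V-paths e₁ → e₂ and e₂ → e₁. Every
-- f₁-critical edge thus has a partner, and β₁ ≤ A₁.
module Submission where

open import Defs hiding (_≺_)
open import Data.Nat using (ℕ; _≤_; suc)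
import Data.Nat.Properties as ℕP
open import Data.Fin using (Fin; zero; suc)
open import Data.Fin.Properties using (injective⇒≤; _≟_; toℕ-injective) renaming (any? to Fin-any?)
open import Data.Fin.Induction using (spo-wellFounded)
import Data.Rational as ℚ
import Data.Rational.Properties as ℚP
open import Data.Product using (Σ; ∃-syntax; _×_; _,_; proj₁; proj₂; uncurry)
open import Data.Sum using (_⊎_; inj₁; inj₂; fromInj₂)
open import Data.List using (List; []; _∷_; length; map; lookup; filter)
open import Data.List.Properties using (length-map)
open import Data.List.Membership.Propositional using (_∈_)
open import Data.List.Membership.Propositional.Properties
  using (∈-lookup; ∈-map⁺; ∈-map⁻; ∈-filter⁺; ∈-filter⁻; ∈-allFin; ∈-cartesianProduct⁺)
open import Data.List.Membership.Setoid.Properties using (index-injective)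
open import Data.List.Relation.Binary.Subset.Propositional using (_⊆_)
open import Data.List.Relation.Unary.Any using (here; there; any?)
open import Data.List.Relation.Unary.All as All using (All; []; _∷_)
open import Data.List.Relation.Unary.All.Properties using (¬Any⇒All¬) renaming (map⁺ to All-map⁺)
open import Data.List.Relation.Unary.AllPairs using ([]; _∷_)
open import Data.List.Relation.Unary.Unique.Propositional using (Unique)
import Data.List.Relation.Unary.Unique.Propositional.Properties as Unique
open import Function using (_∘_; _∘′_; _on_)
open import Function.Bundles using (_⇔_; mk⇔; Equivalence)
open import Function.Properties.Equivalence using () renaming (trans to ⇔-trans; sym to ⇔-sym)
open import Induction.WellFounded using (WellFounded; Acc; acc)
open import Level using (0ℓ)
open import Relation.Nullary using (¬_; ¬?; Dec; yes; no; contradiction)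
open import Relation.Nullary.Decidable
  using (_×-dec_; _⊎-dec_; decidable-stable) renaming (map to Dec-map)
open import Relation.Unary using (Decidable)
open import Relation.Binary using (DecidableEquality; Rel)
import Relation.Binary.Construct.On as On
open import Relation.Binary.PropositionalEquality
  using (_≡_; _≢_; refl; sym; trans; cong; subst; setoid)

module _ {A : Set} where

  lookup-injective : ∀ {xs : List A} → Unique xs → ∀ {i j} → lookup xs i ≡ lookup xs j → i ≡ j
  lookup-injective (x∉ ∷ u) {zero}  {zero}  _  = refl
  lookup-injective (x∉ ∷ u) {zero}  {suc j} eq = contradiction eq (All.lookup x∉ (∈-lookup j))
  lookup-injective (x∉ ∷ u) {suc i} {zero}  eq = contradiction (sym eq) (All.lookup x∉ (∈-lookup i))
  lookup-injective (x∉ ∷ u) {suc i} {suc j} eq = cong suc (lookup-injective u eq)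

  Unique-⊆⇒length-≤ : ∀ {xs ys : List A} → Unique xs → xs ⊆ ys → length xs ≤ length ys
  Unique-⊆⇒length-≤ u xs⊆ys = injective⇒≤ λ eq →
    lookup-injective u (index-injective (setoid A) (xs⊆ys (∈-lookup _)) (xs⊆ys (∈-lookup _)) eq)

  Unique-⊆-length⇒⊇ : DecidableEquality A → ∀ {xs ys : List A} →
    Unique xs → xs ⊆ ys → length ys ≤ length xs → ys ⊆ xs
  Unique-⊆-length⇒⊇ _≟_ {xs} {ys} u xs⊆ys |ys|≤|xs| {y} y∈ys with any? (y ≟_) xs
  ... | yes y∈xs = y∈xs
  ... | no  y∉xs = contradiction (ℕP.≤-trans |y∷xs|≤|ys| |ys|≤|xs|) ℕP.1+n≰n
    where
    y∷xs⊆ys : y ∷ xs ⊆ ys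
    y∷xs⊆ys (here refl)  = y∈ys
    y∷xs⊆ys (there z∈xs) = xs⊆ys z∈xs
    |y∷xs|≤|ys| : suc (length xs) ≤ length ys
    |y∷xs|≤|ys| = Unique-⊆⇒length-≤ (¬Any⇒All¬ xs y∉xs ∷ u) y∷xs⊆ys

  Unique-map⁺-injectiveOn : ∀ {B : Set} {f : A → B} {P : A → Set} →
    (∀ {x y} → P x → P y → f x ≡ f y → x ≡ y) →
    ∀ {xs} → All P xs → Unique xs → Unique (map f xs)
  Unique-map⁺-injectiveOn inj []         []        = []
  Unique-map⁺-injectiveOn inj (px ∷ pxs) (x∉ ∷ u) =
    All-map⁺ (All.zipWith (λ (py , x≢y) → x≢y ∘′ inj px py) (pxs , x∉))
      ∷ Unique-map⁺-injectiveOn inj pxs u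

module _ {A : Set} {P : A → Set} where

  HasCount-resp-⇔ : ∀ {Q : A → Set} {k} → (∀ x → P x ⇔ Q x) → HasCount A P k → HasCount A Q k
  HasCount-resp-⇔ P⇔Q (xs , u , mem , len) = xs , u , (λ x → ⇔-trans (mem x) (P⇔Q x)) , len

  HasCount-filter : ∀ {xs : List A} → Unique xs → (∀ x → x ∈ xs) →
    (P? : Decidable P) → HasCount A P (length (filter P? xs))
  HasCount-filter {xs} u complete P? =
    filter P? xs ,
    Unique.filter⁺ P? u ,
    (λ x → mk⇔ (proj₂ ∘ ∈-filter⁻ P? {xs = xs}) (∈-filter⁺ P? (complete x))) ,
    refl

  HasCount-graph : ∀ {B : Set} {k} (g : A → B) → HasCount A P k →
    HasCount (A × B) (uncurry λ a b → P a × b ≡ g a) k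
  HasCount-graph {B} g (xs , u , mem , len) =
    map graph xs , Unique.map⁺ (cong proj₁) u , (λ _ → mk⇔ to from) , trans (length-map graph xs) len
    where
    graph : A → A × B
    graph a = a , g a
    to : ∀ {a b} → (a , b) ∈ map graph xs → P a × b ≡ g a
    to ab∈ with ∈-map⁻ graph ab∈
    ... | a , a∈xs , refl = Equivalence.to (mem a) a∈xs , refl
    from : ∀ {a b} → P a × b ≡ g a → (a , b) ∈ map graph xs
    from {a} (pa , refl) = ∈-map⁺ graph (Equivalence.from (mem a) pa)

  HasCount-≤ : ∀ {B : Set} {Q : B → Set} {k l} → HasCount A P k → HasCount B Q l →
    (g : B → A) → (∀ {x} → P x → ∃[ y ] Q y × g y ≡ x) → k ≤ l
  HasCount-≤ (xs , u , memP , refl) (ys , _ , memQ , refl) g onto =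
    subst (length xs ≤_) (length-map g ys) (Unique-⊆⇒length-≤ u xs⊆gys)
    where
    xs⊆gys : xs ⊆ map g ys
    xs⊆gys {x} x∈xs with onto (Equivalence.to (memP x) x∈xs)
    ... | y , qy , refl = ∈-map⁺ g (Equivalence.from (memQ y) qy)

  HasCount-injection-onto : ∀ {B : Set} {Q : B → Set} {k} → DecidableEquality B →
    HasCount A P k → HasCount B Q k →
    (f : A → B) → (∀ {x} → P x → Q (f x)) →
    (∀ {x y} → P x → P y → f x ≡ f y → x ≡ y) →
    ∀ {y} → Q y → ∃[ x ] P x × f x ≡ y
  HasCount-injection-onto _≟_ (xs , uxs , memP , refl) (ys , _ , memQ , |ys|≡|xs|) f maps inj {y} qy =
    let x , x∈xs , y≡fx = ∈-map⁻ f (ys⊆fxs (Equivalence.from (memQ y) qy))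
    in x , Equivalence.to (memP x) x∈xs , sym y≡fx
    where
    fxs⊆ys : map f xs ⊆ ys
    fxs⊆ys fx∈ with ∈-map⁻ f fx∈
    ... | x , x∈xs , refl = Equivalence.from (memQ (f x)) (maps (Equivalence.to (memP x) x∈xs))
    ys⊆fxs : ys ⊆ map f xs
    ys⊆fxs = Unique-⊆-length⇒⊇ _≟_
      (Unique-map⁺-injectiveOn inj (All.tabulate (Equivalence.to (memP _))) uxs) fxs⊆ys
      (ℕP.≤-reflexive (trans |ys|≡|xs| (sym (length-map f xs))))

module _ {n m : ℕ} (G : Graph n m) where
  open Graph G

  infix 4 _≺_ _≺?_

  _≺_ : Fin n → Fin m → Set
  _≺_ = Defs._≺_ G

  _≺?_ : ∀ v e → Dec (v ≺ e)
  v ≺? e = (v ≟ src e) ⊎-dec (v ≟ tgt e)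

  other-endpoint : ∀ {v e} → v ≺ e → ∃[ w ] w ≺ e × w ≢ v
  other-endpoint {e = e} (inj₁ refl) = tgt e , inj₂ refl , loopless e ∘ sym
  other-endpoint {e = e} (inj₂ refl) = src e , inj₁ refl , loopless e

  endpoint-cases : ∀ {p u w e} → p ≺ e → u ≺ e → w ≺ e → w ≢ u → p ≡ u ⊎ p ≡ w
  endpoint-cases (inj₁ refl) (inj₁ refl) _           _   = inj₁ refl
  endpoint-cases (inj₂ refl) (inj₂ refl) _           _   = inj₁ refl
  endpoint-cases (inj₁ refl) (inj₂ refl) (inj₁ refl) _   = inj₂ refl
  endpoint-cases (inj₂ refl) (inj₁ refl) (inj₂ refl) _   = inj₂ refl
  endpoint-cases (inj₁ refl) (inj₂ refl) (inj₂ refl) w≢u = contradiction refl w≢u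
  endpoint-cases (inj₂ refl) (inj₁ refl) (inj₁ refl) w≢u = contradiction refl w≢u

  other-endpoint-unique : ∀ {v w w′ e} → v ≺ e → w ≺ e → w′ ≺ e → w ≢ v → w′ ≢ v → w ≡ w′
  other-endpoint-unique v≺e w≺e w′≺e w≢v w′≢v with endpoint-cases w′≺e v≺e w≺e w≢v
  ... | inj₁ w′≡v = contradiction w′≡v w′≢v
  ... | inj₂ w′≡w = sym w′≡w

  Reach-trans : ∀ {u v w} → Reach G u v → Reach G v w → Reach G u w
  Reach-trans (here _)                  r = r
  Reach-trans (there v e w _ v≺e w≺e p) r = there v e w _ v≺e w≺e (Reach-trans p r)

  Reach-sym : ∀ {u v} → Reach G u v → Reach G v u
  Reach-sym (here v)                  = here v
  Reach-sym (there v e w _ v≺e w≺e p) = Reach-trans (Reach-sym p) (there w e v v w≺e v≺e (here v))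

  ComponentRep-unique : ∀ {r r′} → ComponentRep G r → ComponentRep G r′ →
    Reach G r r′ → r ≡ r′
  ComponentRep-unique rep rep′ r↝r′ =
    toℕ-injective (ℕP.≤-antisym (rep _ r↝r′) (rep′ _ (Reach-sym r↝r′)))

  module _ (f : Morse G) where
    open Morse f

    paired? : ∀ v → Dec (∃[ e ] InV G f v e)
    paired? v = Fin-any? λ e → (v ≺? e) ×-dec (fe e ℚ.≤? fv v)

    critical-or-paired : ∀ e → CritE G f e ⊎ ∃[ v ] InV G f v e
    critical-or-paired e with fe e ℚ.≤? fv (src e) | fe e ℚ.≤? fv (tgt e)
    ... | yes e≤src | _         = inj₂ (src e , inj₁ refl , e≤src)
    ... | _         | yes e≤tgt = inj₂ (tgt e , inj₂ refl , e≤tgt)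
    ... | no e≰src  | no e≰tgt  = inj₁ λ { _ (inj₁ refl) → e≰src ; _ (inj₂ refl) → e≰tgt }

    CritE? : Decidable (CritE G f)
    CritE? e with critical-or-paired e
    ... | inj₁ critical         = yes critical
    ... | inj₂ (v , v≺e , e≤v) = no λ critical → critical v v≺e e≤v

    critical-not-paired : ∀ {v e e′} → CritE G f e → InV G f v e′ → e′ ≢ e
    critical-not-paired critical (v≺e , e≤v) refl = critical _ v≺e e≤v

    paired-edge-unique : ∀ {v e e′} → InV G f v e → InV G f v e′ → e ≡ e′
    paired-edge-unique (v≺e , e≤v) (v≺e′ , e′≤v) = vertexCond _ _ _ v≺e v≺e′ e≤v e′≤v

    other-endpoint-below : ∀ {v e w} → InV G f v e → w ≺ e → w ≢ v → fv w ℚ.< fe e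
    other-endpoint-below (inj₁ refl , _)   (inj₁ refl) w≢v = contradiction refl w≢v
    other-endpoint-below (inj₂ refl , _)   (inj₂ refl) w≢v = contradiction refl w≢v
    other-endpoint-below (inj₁ refl , e≤v) (inj₂ refl) _   = ℚP.≰⇒> (edgeCond _ ∘ (e≤v ,_))
    other-endpoint-below (inj₂ refl , e≤v) (inj₁ refl) _   = ℚP.≰⇒> (edgeCond _ ∘ (_, e≤v))

    descent : ∀ {v e w} → InV G f v e → w ≺ e → w ≢ v → fv w ℚ.< fv v
    descent iv w≺e w≢v = ℚP.<-≤-trans (other-endpoint-below iv w≺e w≢v) (proj₂ iv)

    paired-vertex-unique : ∀ {v w e} → InV G f v e → InV G f w e → v ≡ w
    paired-vertex-unique {v} {w} iv (w≺e , e≤w) with v ≟ w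
    ... | yes v≡w = v≡w
    ... | no  v≢w = contradiction
      (ℚP.<-≤-trans (other-endpoint-below iv w≺e (v≢w ∘ sym)) e≤w) (ℚP.<-irrefl refl)

    _⊏_ : Rel (Fin n) 0ℓ
    _⊏_ = ℚ._<_ on fv

    ⊏-wellFounded : WellFounded _⊏_
    ⊏-wellFounded = spo-wellFounded (On.isStrictPartialOrder fv ℚP.<-isStrictPartialOrder)

    descend : ∀ v → ∃[ u ] CritV G f u × VPathV G f v u
    descend v = go v (⊏-wellFounded v)
      where
      go : ∀ v → Acc _⊏_ v → ∃[ u ] CritV G f u × VPathV G f v u
      go v (acc below) with paired? v
      ... | no unpaired = v , (λ e v≺e e≤v → unpaired (e , v≺e , e≤v)) , stop v
      ... | yes (e , iv) =
        let w , w≺e , w≢v      = other-endpoint (proj₁ iv)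
            u , critical , w↝u = go w (below (descent iv w≺e w≢v))
        in u , critical , step v e w u iv w≺e w≢v w↝u

    sink : Fin n → Fin n
    sink v = proj₁ (descend v)

    sink-critical : ∀ v → CritV G f (sink v)
    sink-critical v = proj₁ (proj₂ (descend v))

    path-to-sink : ∀ v → VPathV G f v (sink v)
    path-to-sink v = proj₂ (proj₂ (descend v))

    VPathV-critical-unique : ∀ {v u t} → VPathV G f v u → VPathV G f v t →
      CritV G f u → CritV G f t → u ≡ t
    VPathV-critical-unique (stop _) (stop _) _ _ = refl
    VPathV-critical-unique (stop _) (step _ e _ _ (v≺e , e≤v) _ _ _) cu _ = contradiction e≤v (cu e v≺e)
    VPathV-critical-unique (step _ e _ _ (v≺e , e≤v) _ _ _) (stop _) _ ct = contradiction e≤v (ct e v≺e)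
    VPathV-critical-unique (step _ _ _ _ iv w≺e w≢v p) (step _ _ _ _ iv′ w′≺e′ w′≢v p′) cu ct
      with refl ← paired-edge-unique iv iv′
      with refl ← other-endpoint-unique (proj₁ iv) w≺e w′≺e′ w≢v w′≢v
      = VPathV-critical-unique p p′ cu ct

    sink-of-critical : ∀ {v} → CritV G f v → sink v ≡ v
    sink-of-critical {v} critical =
      VPathV-critical-unique (path-to-sink v) (stop v) (sink-critical v) critical

    VPathV⇒Reach : ∀ {v u} → VPathV G f v u → Reach G v u
    VPathV⇒Reach (stop v)                  = here v
    VPathV⇒Reach (step v e w u iv w≺e _ p) = there v e w u (proj₁ iv) w≺e (VPathV⇒Reach p)

    Reach-sink : ∀ v → Reach G v (sink v)
    Reach-sink v = VPathV⇒Reach (path-to-sink v)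

    Reach-via-sinks : ∀ {v w} → Reach G (sink v) (sink w) → Reach G v w
    Reach-via-sinks s↝s′ = Reach-trans (Reach-sink _) (Reach-trans s↝s′ (Reach-sym (Reach-sink _)))

    FlowsThrough : Fin n → Fin m → Set
    FlowsThrough u e′ = ∃[ e ] InV G f u e × EPathTail G f u e e′

    flowsThrough-step : ∀ {v e w e′} → InV G f v e → w ≺ e → w ≢ v →
      FlowsThrough v e′ ⇔ (e ≡ e′ ⊎ FlowsThrough w e′)
    flowsThrough-step {v} {e} {w} {e′} iv w≺e w≢v = mk⇔ to from
      where
      step-tail : EPathTail G f v e e′ → e ≡ e′ ⊎ FlowsThrough w e′
      step-tail (done _ _) = inj₁ refl
      step-tail (next _ _ w′ e₂ _ w′≺e w′≢v iv₂ tail)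
        with refl ← other-endpoint-unique (proj₁ iv) w′≺e w≺e w′≢v w≢v
        = inj₂ (e₂ , iv₂ , tail)
      to : FlowsThrough v e′ → e ≡ e′ ⊎ FlowsThrough w e′
      to (_ , iv₀ , tail) with refl ← paired-edge-unique iv iv₀ = step-tail tail
      from : e ≡ e′ ⊎ FlowsThrough w e′ → FlowsThrough v e′
      from (inj₁ refl)              = e , iv , done v e
      from (inj₂ (e₂ , iv₂ , tail)) = e , iv , next v e w e₂ e′ w≺e w≢v iv₂ tail

    flowsThrough? : ∀ u e′ → Dec (FlowsThrough u e′)
    flowsThrough? u e′ = go u (⊏-wellFounded u)
      where
      go : ∀ u → Acc _⊏_ u → Dec (FlowsThrough u e′)
      go u (acc below) with paired? u
      ... | no unpaired = no λ (e , iv , _) → unpaired (e , iv)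
      ... | yes (e , iv) =
        let w , w≺e , w≢u = other-endpoint (proj₁ iv)
        in Dec-map (⇔-sym (flowsThrough-step iv w≺e w≢u))
             ((e ≟ e′) ⊎-dec go w (below (descent iv w≺e w≢u)))

    flowsThrough-descends : ∀ {u e′ x} → FlowsThrough u e′ → InV G f x e′ → fv x ℚ.≤ fv u
    flowsThrough-descends (_ , iv , tail) = go iv tail
      where
      go : ∀ {u e e′ x} → InV G f u e → EPathTail G f u e e′ → InV G f x e′ → fv x ℚ.≤ fv u
      go iu (done _ _)                         ix = ℚP.≤-reflexive (cong fv (paired-vertex-unique ix iu))
      go iu (next _ _ _ _ _ w≺e w≢u iw tail) ix =
        ℚP.≤-trans (go iw tail ix) (ℚP.<⇒≤ (descent iu w≺e w≢u))

    ¬flowsThrough-other-endpoint : ∀ {v e w} → InV G f v e → w ≺ e → w ≢ v → ¬ FlowsThrough w e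
    ¬flowsThrough-other-endpoint iv w≺e w≢v flow =
      ℚP.<-irrefl refl (ℚP.<-≤-trans (descent iv w≺e w≢v) (flowsThrough-descends flow iv))

    VPathV⇒flowsThrough : ∀ {x u e} → VPathV G f x u → InV G f u e → FlowsThrough x e
    VPathV⇒flowsThrough (stop _)                    iv = _ , iv , done _ _
    VPathV⇒flowsThrough (step _ _ _ _ ix w≺e w≢x p) iv =
      Equivalence.from (flowsThrough-step ix w≺e w≢x) (inj₂ (VPathV⇒flowsThrough p iv))

    flowsThrough⇒VPathE : ∀ {v e₀ e′} → v ≺ e₀ → FlowsThrough v e′ → VPathE G f e₀ e′
    flowsThrough⇒VPathE v≺e₀ (e , iv , tail) = inj₂ (_ , e , v≺e₀ , iv , tail)

    VPathE? : ∀ e₀ e′ → Dec (VPathE G f e₀ e′)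
    VPathE? e₀ e′ =
      (e₀ ≟ e′) ⊎-dec
      Dec-map (mk⇔ to from) (Fin-any? λ v → (v ≺? e₀) ×-dec flowsThrough? v e′)
      where
      Start : Set
      Start = ∃[ v ] ∃[ e ] v ≺ e₀ × InV G f v e × EPathTail G f v e e′
      to : ∃[ v ] v ≺ e₀ × FlowsThrough v e′ → Start
      to (v , v≺e₀ , e , iv , tail) = v , e , v≺e₀ , iv , tail
      from : Start → ∃[ v ] v ≺ e₀ × FlowsThrough v e′
      from (v , e , v≺e₀ , iv , tail) = v , v≺e₀ , e , iv , tail

    record Exit (Q : Fin n → Set) (x : Fin n) : Set where
      constructor exit
      field
        {inner outer} : Fin n
        edge          : Fin m
        path          : VPathV G f x inner
        paired        : InV G f inner edge
        outer≺edge    : outer ≺ edge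
        outer≢inner   : outer ≢ inner
        inner∈Q       : Q inner
        outer∉Q       : ¬ Q outer

    exit-of : ∀ {Q : Fin n → Set} → Decidable Q →
      ∀ {x y} → VPathV G f x y → Q x → ¬ Q y → Exit Q x
    exit-of Q? (stop _) qx ¬qy = contradiction qx ¬qy
    exit-of Q? (step x e w _ ix w≺e w≢x p) qx ¬qy with Q? w
    ... | no ¬qw = exit e (stop x) ix w≺e w≢x qx ¬qw
    ... | yes qw =
      let exit e′ p′ iu w′≺e′ w′≢u qu ¬qw′ = exit-of Q? p qw ¬qy
      in exit e′ (step x e w _ ix w≺e w≢x p′) iu w′≺e′ w′≢u qu ¬qw′

  module _ (f : Morse G) {b₀ : ℕ} (β₀ : IsBetti0 G b₀)
           (criticals : HasCount (Fin n) (CritV G f) b₀) where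

    critical-is-sink-of-rep : ∀ {c} → CritV G f c → ∃[ r ] ComponentRep G r × sink f r ≡ c
    critical-is-sink-of-rep =
      HasCount-injection-onto _≟_ β₀ criticals (sink f) (λ {r} _ → sink-critical f r)
        (λ rep rep′ s≡s′ → ComponentRep-unique rep rep′
           (Reach-via-sinks f (subst (Reach G _) s≡s′ (here _))))

    critical-unique-in-component : ∀ {c c′} → CritV G f c → CritV G f c′ →
      Reach G c c′ → c ≡ c′
    critical-unique-in-component critical critical′ c↝c′
      with r  , rep  , refl ← critical-is-sink-of-rep critical
      with r′ , rep′ , refl ← critical-is-sink-of-rep critical′
      = cong (sink f) (ComponentRep-unique rep rep′ (Reach-via-sinks f c↝c′))

    sink-resp-Reach : ∀ {v w} → Reach G v w → sink f v ≡ sink f w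
    sink-resp-Reach v↝w = critical-unique-in-component (sink-critical f _) (sink-critical f _)
      (Reach-trans (Reach-sym (Reach-sink f _)) (Reach-trans v↝w (Reach-sink f _)))

  SCEdgePair? : (f₁ f₂ : Morse G) → Decidable (SCEdgePair G f₁ f₂)
  SCEdgePair? f₁ f₂ (e₁ , e₂) =
    CritE? f₁ e₁ ×-dec CritE? f₂ e₂ ×-dec VPathE? f₁ e₁ e₂ ×-dec VPathE? f₂ e₂ e₁

  module _ (f₁ f₂ : Morse G)
           (sink₁-resp-Reach : ∀ {v w} → Reach G v w → sink f₁ v ≡ sink f₁ w) where

    SCVertexPair⇔sink : ∀ v₁ v₂ →
      SCVertexPair G f₁ f₂ (v₁ , v₂) ⇔ (CritV G f₁ v₁ × v₂ ≡ sink f₂ v₁)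
    SCVertexPair⇔sink v₁ v₂ = mk⇔ to from
      where
      to : SCVertexPair G f₁ f₂ (v₁ , v₂) → CritV G f₁ v₁ × v₂ ≡ sink f₂ v₁
      to (critical₁ , critical₂ , v₁↝v₂ , _) =
        critical₁ ,
        VPathV-critical-unique f₂ v₁↝v₂ (path-to-sink f₂ v₁) critical₂ (sink-critical f₂ v₁)
      back : CritV G f₁ v₁ → sink f₁ (sink f₂ v₁) ≡ v₁
      back critical₁ =
        trans (sink₁-resp-Reach (Reach-sym (Reach-sink f₂ v₁))) (sink-of-critical f₁ critical₁)
      from : CritV G f₁ v₁ × v₂ ≡ sink f₂ v₁ → SCVertexPair G f₁ f₂ (v₁ , v₂)
      from (critical₁ , v₂≡sink) rewrite v₂≡sink =
        critical₁ , sink-critical f₂ v₁ , path-to-sink f₂ v₁ ,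
        subst (VPathV G f₁ (sink f₂ v₁)) (back critical₁) (path-to-sink f₁ (sink f₂ v₁))

    SCVertexPair-count : ∀ {k} → HasCount (Fin n) (CritV G f₁) k →
      HasCount (Fin n × Fin n) (SCVertexPair G f₁ f₂) k
    SCVertexPair-count criticals =
      HasCount-resp-⇔ (λ (v₁ , v₂) → ⇔-sym (SCVertexPair⇔sink v₁ v₂))
        (HasCount-graph (sink f₂) criticals)

    module _ {e₁ : Fin m} (critical₁ : CritE G f₁ e₁) where

      Upstream : Fin n → Set
      Upstream u = FlowsThrough f₂ u e₁

      Upstream? : Decidable Upstream
      Upstream? u = flowsThrough? f₂ u e₁

      Upstream-resp-paired : ∀ {e p q} → e ≢ e₁ → InV G f₂ p e → q ≺ e → q ≢ p →
        Upstream p ⇔ Upstream q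
      Upstream-resp-paired {e} {p} {q} e≢e₁ ip q≺e q≢p =
        mk⇔ (fromInj₂ (λ e≡e₁ → contradiction e≡e₁ e≢e₁) ∘ Equivalence.to p-step)
            (Equivalence.from p-step ∘ inj₂)
        where
        p-step : Upstream p ⇔ (e ≡ e₁ ⊎ Upstream q)
        p-step = flowsThrough-step f₂ ip q≺e q≢p

      separating-edge-critical : ∀ {e a b} → e ≢ e₁ → a ≺ e → b ≺ e → b ≢ a →
        Upstream a → ¬ Upstream b → CritE G f₂ e
      separating-edge-critical e≢e₁ a≺e b≺e b≢a up-a ¬up-b p p≺e e≤p
        with endpoint-cases p≺e a≺e b≺e b≢a
      ... | inj₁ refl = ¬up-b (Equivalence.to (Upstream-resp-paired e≢e₁ (p≺e , e≤p) b≺e b≢a) up-a)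
      ... | inj₂ refl =
        ¬up-b (Equivalence.from (Upstream-resp-paired e≢e₁ (p≺e , e≤p) a≺e (b≢a ∘ sym)) up-a)

      separating-edge-partner : ∀ {x u e a b} → x ≺ e₁ → VPathV G f₁ x u → InV G f₁ u e →
        a ≺ e → b ≺ e → b ≢ a → Upstream a → ¬ Upstream b → SCEdgePair G f₁ f₂ (e₁ , e)
      separating-edge-partner x≺e₁ x↝u iu a≺e b≺e b≢a up-a ¬up-b =
        critical₁ ,
        separating-edge-critical (critical-not-paired f₁ critical₁ iu) a≺e b≺e b≢a up-a ¬up-b ,
        flowsThrough⇒VPathE f₁ x≺e₁ (VPathV⇒flowsThrough f₁ x↝u iu) ,
        flowsThrough⇒VPathE f₂ a≺e up-a

      partner-of-paired : ∀ {a b} → InV G f₂ b e₁ → a ≺ e₁ → a ≢ b →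
        ∃[ e ] SCEdgePair G f₁ f₂ (e₁ , e)
      partner-of-paired {a} {b} ib a≺e₁ a≢b with Upstream? (sink f₁ b)
      ... | no ¬up-sink =
        let exit e b↝u iu w≺e w≢u up-u ¬up-w =
              exit-of f₁ Upstream? (path-to-sink f₁ b) up-b ¬up-sink
        in e , separating-edge-partner (proj₁ ib) b↝u iu (proj₁ iu) w≺e w≢u up-u ¬up-w
        where
        up-b : Upstream b
        up-b = e₁ , ib , done b e₁
      ... | yes up-sink =
        let exit e a↝u iu w≺e w≢u ¬up-u ¬¬up-w =
              exit-of f₁ (¬? ∘ Upstream?) (path-to-sink f₁ a) ¬up-a (λ ¬up → ¬up up-sinkₐ)
        in e , separating-edge-partner a≺e₁ a↝u iu w≺e (proj₁ iu) (w≢u ∘ sym)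
                 (decidable-stable (Upstream? _) ¬¬up-w) ¬up-u
        where
        ¬up-a : ¬ Upstream a
        ¬up-a = ¬flowsThrough-other-endpoint f₂ ib a≺e₁ a≢b
        up-sinkₐ : Upstream (sink f₁ a)
        up-sinkₐ = subst Upstream
          (sym (sink₁-resp-Reach (there a e₁ b b a≺e₁ (proj₁ ib) (here b)))) up-sink

      partner : ∃[ e ] SCEdgePair G f₁ f₂ (e₁ , e)
      partner with critical-or-paired f₂ e₁
      ... | inj₁ critical₂ = e₁ , critical₁ , critical₂ , inj₁ refl , inj₁ refl
      ... | inj₂ (b , ib)  =
        let a , a≺e₁ , a≢b = other-endpoint (proj₁ ib) in partner-of-paired ib a≺e₁ a≢b

    SCEdgePair-count-≥ : ∀ {k} → HasCount (Fin m) (CritE G f₁) k →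
      ∃[ l ] HasCount (Fin m × Fin m) (SCEdgePair G f₁ f₂) l × k ≤ l
    SCEdgePair-count-≥ criticals =
      let l , pairs = SCEdgePair-count
      in l , pairs , HasCount-≤ criticals pairs proj₁ λ critical₁ →
           let e , strongly-connected = partner critical₁ in (_ , e) , strongly-connected , refl
      where
      SCEdgePair-count : ∃[ l ] HasCount (Fin m × Fin m) (SCEdgePair G f₁ f₂) l
      SCEdgePair-count =
        _ , HasCount-filter (Unique.cartesianProduct⁺ (Unique.allFin⁺ m) (Unique.allFin⁺ m))
              (λ (e , e′) → ∈-cartesianProduct⁺ (∈-allFin e) (∈-allFin e′)) (SCEdgePair? f₁ f₂)

corollary4p4 : ∀ {n m} (G : Graph n m) (f₁ f₂ : Morse G) →
    Excellent G f₁ → Excellent G f₂ →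
    ∀ (b₀ : ℕ) → IsBetti0 G b₀ →
    Optimal G f₁ b₀ → Optimal G f₂ b₀ →
    HasCount (Fin n × Fin n) (SCVertexPair G f₁ f₂) b₀
    × Σ ℕ (λ k → HasCount (Fin m × Fin m) (SCEdgePair G f₁ f₂) k × betti1 G b₀ ≤ k)
corollary4p4 G f₁ f₂ _ _ b₀ β₀ (criticalV₁ , criticalE₁) _ =
  SCVertexPair-count G f₁ f₂ sink₁-resp-Reach criticalV₁ ,
  SCEdgePair-count-≥ G f₁ f₂ sink₁-resp-Reach criticalE₁
  where
  sink₁-resp-Reach : ∀ {v w} → Reach G v w → sink G f₁ v ≡ sink G f₁ w
  sink₁-resp-Reach = sink-resp-Reach G f₁ β₀ criticalV₁
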